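{- Let $L$ be a first-order language and $L_s=L\cup\{|\}$. For every $L$-structure $\mathcal M$, every choice function $f$ for $Fml(L)$, and every sentence $\sigma$ of $L_s$ that is an instance of the scheme $$(D)\qquad \forall v(\varphi\rightarrow\psi(v))\rightarrow(\varphi\rightarrow\forall v\,\psi(v)),$$ where $\varphi,\psi(v)\in Fml(L_s)$ and $v$ does not occur free in $\varphi$, we have $\langle\mathcal M,f\rangle\models^1_s\sigma$. That is, $D$ is a scheme of tautologies with respect to the formula choice semantics.
   Context: $L$ is a first-order language with logical symbols $\wedge,\neg,\forall$ and equality; the other connectives and $\exists=\neg\forall\neg$ are abbreviations. $L_s=L\cup\{|\}$, where $|$ is a new binary connective; $Fml(L_s)$ is the set of all formulas built by the usual recursion together with the clause that $\varphi|\psi$ is a formula whenever $\varphi,\psi$ are. $Fml(L)$ is the set of formulas of $L$. A choice function for $Fml(L)$ is a map $f$ assigning to each unordered pair $\{\alpha,\beta\}$ of formulas of $L$ (singletons included) an element $f(\alpha,\beta)\in\{\alpha,\beta\}$; thus $f(\alpha,\beta)=f(\beta,\alpha)$ and $f(\alpha,\alpha)=\alpha$. Its collapsing map $\overline f:Fml(L_s)\to Fml(L)$ is defined recursively by $\overline f(\alpha)=\alpha$ for $\alpha\in Fml(L)$, $\overline f(\varphi\wedge\psi)=\overline f(\varphi)\wedge\overline f(\psi)$, $\overline f(\neg\varphi)=\neg\overline f(\varphi)$, $\overline f(\forall v\varphi)=\forall v\,\overline f(\varphi)$, $\overline f(\varphi|\psi)=f(\overline f(\varphi),\overline f(\psi))$.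 For an $L$-structure $\mathcal M$ and a sentence $\varphi$ of $L_s$, the formula choice semantics truth relation is $\langle\mathcal M,f\rangle\models^1_s\varphi$ iff $\mathcal M\models\overline f(\varphi)$ (ordinary Tarskian satisfaction). -}

module Defs where

open import Data.Nat using (ℕ; _≟_)
open import Data.Fin using (Fin)
open import Data.Vec using (Vec; []; _∷_; lookup)
open import Data.Product using (_×_; Σ; ∃-syntax)
open import Data.Sum using (_⊎_)
open import Relation.Nullary using (¬_; yes; no)
open import Relation.Binary.PropositionalEquality using (_≡_)

-- A first-order signature L: function symbols (constants = arity 0)
-- and relation symbols, each with an arity.
record Lang : Set₁ where
  field
    Func     : Set
    funArity : Func → ℕ
    Rel      : Set
    relArity : Rel → ℕ
open Lang public

Var : Set
Var = ℕ

data Term (L : Lang) : Set where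
  var : Var → Term L
  app : (g : Func L) → Vec (Term L) (funArity L g) → Term L

data Fml (L : Lang) : Set where
  rel  : (r : Rel L) → Vec (Term L) (relArity L r) → Fml L
  _≐_  : Term L → Term L → Fml L
  _∧_  : Fml L → Fml L → Fml L
  ¬'_  : Fml L → Fml L
  ∀'   : Var → Fml L → Fml L

data FmlS (L : Lang) : Set where
  rel  : (r : Rel L) → Vec (Term L) (relArity L r) → FmlS L
  _≐_  : Term L → Term L → FmlS L
  _∧_  : FmlS L → FmlS L → FmlS L
  ¬'_  : FmlS L → FmlS L
  ∀'   : Var → FmlS L → FmlS L
  _∣_  : FmlS L → FmlS L → FmlS L

_⇒_ : ∀ {L} → FmlS L → FmlS L → FmlS L
φ ⇒ ψ = ¬' (φ ∧ (¬' ψ))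

data _occursIn_ {L : Lang} (v : Var) : Term L → Set where
  here : v occursIn var v
  arg  : ∀ {g ts} (i : Fin (funArity L g)) → v occursIn lookup ts i → v occursIn app g ts

data FreeIn {L : Lang} (v : Var) : FmlS L → Set where
  rel  : ∀ {r ts} (i : Fin (relArity L r)) → v occursIn lookup ts i → FreeIn v (rel r ts)
  eqˡ  : ∀ {t u} → v occursIn t → FreeIn v (t ≐ u)
  eqʳ  : ∀ {t u} → v occursIn u → FreeIn v (t ≐ u)
  andˡ : ∀ {φ ψ} → FreeIn v φ → FreeIn v (φ ∧ ψ)
  andʳ : ∀ {φ ψ} → FreeIn v ψ → FreeIn v (φ ∧ ψ)
  neg  : ∀ {φ} → FreeIn v φ → FreeIn v (¬' φ)
  all  : ∀ {w φ} → ¬ (v ≡ w) → FreeIn v φ → FreeIn v (∀' w φ)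
  barˡ : ∀ {φ ψ} → FreeIn v φ → FreeIn v (φ ∣ ψ)
  barʳ : ∀ {φ ψ} → FreeIn v ψ → FreeIn v (φ ∣ ψ)

IsSentence : ∀ {L} → FmlS L → Set
IsSentence σ = ∀ v → ¬ FreeIn v σ

-- Choice function for Fml(L): picks an element of each unordered pair.
record ChoiceFunction (L : Lang) : Set where
  field
    choose    : Fml L → Fml L → Fml L
    chooses   : ∀ α β → choose α β ≡ α ⊎ choose α β ≡ β
    symmetric : ∀ α β → choose α β ≡ choose β α
open ChoiceFunction public

collapse : ∀ {L} → ChoiceFunction L → FmlS L → Fml L
collapse f (rel r ts) = rel r ts
collapse f (t ≐ u)    = t ≐ u
collapse f (φ ∧ ψ)    = collapse f φ ∧ collapse f ψ
collapse f (¬' φ)     = ¬' collapse f φ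
collapse f (∀' v φ)   = ∀' v (collapse f φ)
collapse f (φ ∣ ψ)    = choose f (collapse f φ) (collapse f ψ)

-- L-structures (nonempty domain).
record Structure (L : Lang) : Set₁ where
  field
    Dom  : Set
    elt  : Dom
    funI : (g : Func L) → Vec Dom (funArity L g) → Dom
    relI : (r : Rel L) → Vec Dom (relArity L r) → Set
open Structure public

module _ {L : Lang} (M : Structure L) where
  Assignment : Set
  Assignment = Var → Dom M

  _[_↦_] : Assignment → Var → Dom M → Assignment
  (ρ [ v ↦ m ]) w with w ≟ v
  ... | yes _ = m
  ... | no  _ = ρ w

  mutual
    evalT : Assignment → Term L → Dom M
    evalT ρ (var v)    = ρ v
    evalT ρ (app g ts) = funI M g (evalTs ρ ts)

    evalTs : ∀ {n} → Assignment → Vec (Term L) n → Vec (Dom M) n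
    evalTs ρ []       = []
    evalTs ρ (t ∷ ts) = evalT ρ t ∷ evalTs ρ ts

  Sat : Assignment → Fml L → Set
  Sat ρ (rel r ts) = relI M r (evalTs ρ ts)
  Sat ρ (t ≐ u)    = evalT ρ t ≡ evalT ρ u
  Sat ρ (φ ∧ ψ)    = Sat ρ φ × Sat ρ ψ
  Sat ρ (¬' φ)     = ¬ Sat ρ φ
  Sat ρ (∀' v φ)   = ∀ (m : Dom M) → Sat (ρ [ v ↦ m ]) φ

  _⊨_ : Fml L → Set
  _⊨_ α = ∀ (ρ : Assignment) → Sat ρ α

⟨_,_⟩⊨¹ₛ_ : ∀ {L} → Structure L → ChoiceFunction L → FmlS L → Set
⟨ M , f ⟩⊨¹ₛ φ = M ⊨ collapse f φ

D-instance : ∀ {L} → FmlS L → Set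
D-instance {L} σ = ∃[ φ ] ∃[ ψ ] ∃[ v ]
  (¬ FreeIn v φ × σ ≡ (∀' v (φ ⇒ ψ) ⇒ (φ ⇒ ∀' v ψ)))

{-# OPTIONS --safe #-}
module Submission where

-- The collapse of an instance of (D) is an instance of (D) in L itself: f̄ commutes with
-- the connectives and quantifiers, and it cannot create free variables because f always
-- returns one of its two arguments. An instance of (D) in L is classically valid, because
-- reassigning a variable that is not free in φ does not change the truth of φ.

open import Level using (0ℓ)
open import Axiom.ExcludedMiddle using (ExcludedMiddle)
open import Axiom.DoubleNegationElimination using (DoubleNegationElimination; em⇒dne)
open import Defs
open import Data.Nat using (_≟_)
open import Data.Fin using (Fin; zero; suc)
open import Data.Vec using (Vec; []; _∷_; lookup)
open import Data.Product using (_,_)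
open import Data.Sum using (inj₁; inj₂)
open import Relation.Nullary using (¬_; yes; no; contradiction)
open import Relation.Binary.PropositionalEquality using (_≡_; refl; sym; trans; cong; cong₂; subst)

module _ {L : Lang} where

  _⇒ᴸ_ : Fml L → Fml L → Fml L
  α ⇒ᴸ β = ¬' (α ∧ (¬' β))

  data FreeInᴸ (v : Var) : Fml L → Set where
    rel  : ∀ {r ts} (i : Fin (relArity L r)) → v occursIn lookup ts i → FreeInᴸ v (rel r ts)
    eqˡ  : ∀ {t u} → v occursIn t → FreeInᴸ v (t ≐ u)
    eqʳ  : ∀ {t u} → v occursIn u → FreeInᴸ v (t ≐ u)
    andˡ : ∀ {α β} → FreeInᴸ v α → FreeInᴸ v (α ∧ β)
    andʳ : ∀ {α β} → FreeInᴸ v β → FreeInᴸ v (α ∧ β)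
    neg  : ∀ {α} → FreeInᴸ v α → FreeInᴸ v (¬' α)
    all  : ∀ {w α} → ¬ (v ≡ w) → FreeInᴸ v α → FreeInᴸ v (∀' w α)

  FreeIn-collapse : ∀ (f : ChoiceFunction L) {v} φ → FreeInᴸ v (collapse f φ) → FreeIn v φ
  FreeIn-collapse f (rel r ts) (rel i o) = rel i o
  FreeIn-collapse f (t ≐ u)    (eqˡ o)   = eqˡ o
  FreeIn-collapse f (t ≐ u)    (eqʳ o)   = eqʳ o
  FreeIn-collapse f (φ ∧ ψ)    (andˡ p)  = andˡ (FreeIn-collapse f φ p)
  FreeIn-collapse f (φ ∧ ψ)    (andʳ p)  = andʳ (FreeIn-collapse f ψ p)
  FreeIn-collapse f (¬' φ)     (neg p)   = neg (FreeIn-collapse f φ p)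
  FreeIn-collapse f (∀' w φ)   (all v≢w p) = all v≢w (FreeIn-collapse f φ p)
  FreeIn-collapse f {v} (φ ∣ ψ) p with chooses f (collapse f φ) (collapse f ψ)
  ... | inj₁ eq = barˡ (FreeIn-collapse f φ (subst (FreeInᴸ v) eq p))
  ... | inj₂ eq = barʳ (FreeIn-collapse f ψ (subst (FreeInᴸ v) eq p))

  module _ (M : Structure L) where

    mutual
      evalT-cong : ∀ {ρ ρ′ : Assignment M} t →
                   (∀ w → w occursIn t → ρ w ≡ ρ′ w) → evalT M ρ t ≡ evalT M ρ′ t
      evalT-cong (var w)    agree = agree w here
      evalT-cong (app g ts) agree =
        cong (funI M g) (evalTs-cong ts (λ i w o → agree w (arg i o)))

      evalTs-cong : ∀ {n} {ρ ρ′ : Assignment M} (ts : Vec (Term L) n) →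
                    (∀ i w → w occursIn lookup ts i → ρ w ≡ ρ′ w) →
                    evalTs M ρ ts ≡ evalTs M ρ′ ts
      evalTs-cong []       agree = refl
      evalTs-cong (t ∷ ts) agree =
        cong₂ _∷_ (evalT-cong t (agree zero)) (evalTs-cong ts (λ i → agree (suc i)))

    update-cong : ∀ {ρ ρ′ : Assignment M} v m w →
                  (¬ w ≡ v → ρ w ≡ ρ′ w) → _[_↦_] M ρ v m w ≡ _[_↦_] M ρ′ v m w
    update-cong v m w agree with w ≟ v
    ... | yes _   = refl
    ... | no w≢v  = agree w≢v

    update-≢ : ∀ (ρ : Assignment M) {v} m {w} → ¬ w ≡ v → _[_↦_] M ρ v m w ≡ ρ w
    update-≢ ρ {v} m {w} w≢v with w ≟ v
    ... | yes w≡v = contradiction w≡v w≢v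
    ... | no _    = refl

    Sat-coincidence : ∀ {ρ ρ′ : Assignment M} α →
                      (∀ w → FreeInᴸ w α → ρ w ≡ ρ′ w) → Sat M ρ α → Sat M ρ′ α
    Sat-coincidence (rel r ts) agree s =
      subst (relI M r) (evalTs-cong ts (λ i w o → agree w (rel i o))) s
    Sat-coincidence (t ≐ u) agree s =
      trans (sym (evalT-cong t (λ w o → agree w (eqˡ o))))
            (trans s (evalT-cong u (λ w o → agree w (eqʳ o))))
    Sat-coincidence (α ∧ β) agree (a , b) =
      Sat-coincidence α (λ w p → agree w (andˡ p)) a ,
      Sat-coincidence β (λ w p → agree w (andʳ p)) b
    Sat-coincidence (¬' α) agree ¬a a′ =
      ¬a (Sat-coincidence α (λ w p → sym (agree w (neg p))) a′)
    Sat-coincidence (∀' v α) agree s m =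
      Sat-coincidence α (λ w p → update-cong v m w (λ w≢v → agree w (all w≢v p))) (s m)

    Sat-update-nonfree : ∀ (ρ : Assignment M) {v} m α →
                         ¬ FreeInᴸ v α → Sat M ρ α → Sat M (_[_↦_] M ρ v m) α
    Sat-update-nonfree ρ {v} m α v∉α =
      Sat-coincidence α λ w w∈α →
        sym (update-≢ ρ m (λ { refl → v∉α w∈α }))

    D-valid : DoubleNegationElimination 0ℓ → ∀ α β v → ¬ FreeInᴸ v α →
              M ⊨ (∀' v (α ⇒ᴸ β) ⇒ᴸ (α ⇒ᴸ ∀' v β))
    D-valid dne α β v v∉α ρ (α⇒β , ¬[α⇒∀β]) =
      ¬[α⇒∀β] λ (a , ¬∀β) → ¬∀β λ m →
        dne λ ¬b → α⇒β m (Sat-update-nonfree ρ m α v∉α a , ¬b)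

fact3p2 : ExcludedMiddle 0ℓ →
    (L : Lang) (M : Structure L) (f : ChoiceFunction L) (σ : FmlS L) →
    IsSentence σ → D-instance σ → ⟨ M , f ⟩⊨¹ₛ σ
fact3p2 em L M f _ _ (φ , ψ , v , v∉φ , refl) =
  D-valid M (em⇒dne em) (collapse f φ) (collapse f ψ) v
    (λ v∈f̄φ → v∉φ (FreeIn-collapse f φ v∈f̄φ))
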